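{- Let $m \geq 1$ and $k \geq 2$ be integers, let $G$ be a complete multipartite graph, and let $w$ and $w'$ be $m$-weightings of $G$ such that $w'$ is uniform-$\alpha$. Then $\pi_k(G(w')) \leq \pi_k(G(w))$.
   Context: All graphs are simple. $\mathbb{N}_0 = \{0,1,2,\dots\}$, $[n]=\{1,\dots,n\}$. For a graph $G$, a function $w: V(G) \to \mathbb{N}_0$ with $\sum_{v \in V(G)} w(v) = m$ is an $m$-weighting of $G$. $G(w)$ is the graph obtained from $G$ by replacing each vertex $v$ by a clique $K^v$ on $w(v)$ vertices and joining every vertex of $K^u$ to every vertex of $K^v$ whenever $uv \in E(G)$. $\pi_k(H)$ denotes the number of $k$-cliques of a graph $H$. For $U \subseteq V(G)$, an $m$-weighting $w$ is uniform on $U$ if $w(v)=0$ for all $v \notin U$ and $w(u) \in \{\lfloor m/|U|\rfloor, \lceil m/|U| \rceil\}$ for all $u \in U$; $w$ is uniform-$\alpha$ if it is uniform on some independent set of $G$ of maximum size. A complete multipartite graph is a graph whose vertex set is the union of pairwise disjoint non-empty sets $I_1,\dots,I_r$ (its maximal partite sets), with $xy$ an edge iff $x$ and $y$ lie in different sets $I_i$, $I_j$. -}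

module Defs where

open import Data.Nat using (ℕ; zero; suc; _+_; _∸_; _/_; _≤_; _<_; NonZero)
open import Data.Nat.Base using (_≡ᵇ_)
open import Data.Bool using (Bool; true; false; _∧_; _∨_; not; if_then_else_)
open import Data.Fin using (Fin; _≟_)
open import Data.Fin.Subset using (Subset; _∈_; _∉_; ∣_∣)
open import Data.List using (List; []; _∷_; map; _++_; concatMap; upTo; allFin; length; filter)
open import Data.Nat.ListAction using (sum)
open import Data.Bool.ListAction using (all)
open import Data.Product using (Σ; ∃; _×_; _,_)
open import Data.Sum using (_⊎_)
open import Relation.Nullary using (¬_; does)
open import Relation.Binary.PropositionalEquality using (_≡_; _≢_)
open import Function.Bundles using (_⇔_)
open import Function.Definitions using (Surjective)

record Graph : Set where
  field
    n      : ℕ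
    adj    : Fin n → Fin n → Bool
    sym    : ∀ x y → adj x y ≡ adj y x
    irrefl : ∀ x → adj x x ≡ false
open Graph public

-- Complete multipartite: the vertex set is partitioned into r non-empty
-- parts (given by a surjective labelling f : Fin n → Fin r; the parts are
-- the fibres), and x y adjacent iff they lie in different parts.
IsCompleteMultipartite : Graph → Set
IsCompleteMultipartite G =
  Σ ℕ λ r → Σ (Fin (n G) → Fin r) λ f →
    Surjective _≡_ _≡_ f × (∀ x y → (adj G x y ≡ true) ⇔ (f x ≢ f y))

total : (G : Graph) → (Fin (n G) → ℕ) → ℕ
total G w = sum (map w (allFin (n G)))

IsWeighting : (G : Graph) → ℕ → (Fin (n G) → ℕ) → Set
IsWeighting G m w = total G w ≡ m

-- Blow-up G(w): vertex (v , i) with i < w v is the i-th vertex of clique K^v.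
blowupVertices : (G : Graph) → (Fin (n G) → ℕ) → List (Fin (n G) × ℕ)
blowupVertices G w = concatMap (λ v → map (λ i → (v , i)) (upTo (w v))) (allFin (n G))

blowupAdj : (G : Graph) → Fin (n G) × ℕ → Fin (n G) × ℕ → Bool
blowupAdj G (u , i) (v , j) =
  (does (u ≟ v) ∧ not (i ≡ᵇ j)) ∨ adj G u v

-- all k-element sublists of a list (k-subsets of a duplicate-free list)
choose : {A : Set} → ℕ → List A → List (List A)
choose zero    xs       = [] ∷ []
choose (suc k) []       = []
choose (suc k) (x ∷ xs) = map (x ∷_) (choose k xs) ++ choose (suc k) xs

isClique : {A : Set} → (A → A → Bool) → List A → Bool
isClique adj []       = true
isClique adj (x ∷ xs) = all (adj x) xs ∧ isClique adj xs

cliqueCount : {A : Set} → ℕ → List A → (A → A → Bool) → ℕ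
cliqueCount k vs adj = length (filter (λ c → isClique adj c Data.Bool.≟ true) (choose k vs))

πBlowup : ℕ → (G : Graph) → (Fin (n G) → ℕ) → ℕ
πBlowup k G w = cliqueCount k (blowupVertices G w) (blowupAdj G)

IsIndependent : (G : Graph) → Subset (n G) → Set
IsIndependent G U = ∀ x y → x ∈ U → y ∈ U → adj G x y ≡ false

IsMaxIndependent : (G : Graph) → Subset (n G) → Set
IsMaxIndependent G U =
  IsIndependent G U × (∀ U′ → IsIndependent G U′ → ∣ U′ ∣ ≤ ∣ U ∣)

-- w is uniform on U (as an m-weighting): w v = 0 off U, and
-- w u ∈ {⌊m/|U|⌋, ⌈m/|U|⌉} on U.  (U must be non-empty for m/|U| to make sense.)
IsUniformOn : (G : Graph) → ℕ → Subset (n G) → (Fin (n G) → ℕ) → Set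
IsUniformOn G m U w =
  Σ (NonZero ∣ U ∣) λ nz →
    (∀ v → v ∉ U → w v ≡ 0) ×
    (∀ u → u ∈ U →
       (w u ≡ _/_ m ∣ U ∣ {{nz}}) ⊎ (w u ≡ _/_ (m + ∣ U ∣ ∸ 1) ∣ U ∣ {{nz}}))

IsUniformα : (G : Graph) → ℕ → (Fin (n G) → ℕ) → Set
IsUniformα G m w = Σ (Subset (n G)) λ U → IsMaxIndependent G U × IsUniformOn G m U w

-- Let α = ∣U∣, q = ⌊m/α⌋ and c = C(q, k−1). By Pascal's rule the increments of x ↦ C(x, k) are
-- nondecreasing, so C(x, k) ≥ C(q, k) + (x − q)c, with equality for x ∈ {q, q+1}.
-- Upper bound: U is independent and w′ vanishes off U, so every clique of G(w′) lies in a single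
-- K^v, hence π_k(G(w′)) ≤ Σ_v C(w′(v), k) = αC(q, k) + (m − αq)c, as w′(v) ∈ {q, q+1} on U.
-- Lower bound: the parts of G are independent, so they have at most α vertices; numbering the
-- vertices of each part splits V(G) into α cliques, whose blow-ups split G(w) into α cliques of
-- sizes n_j with Σ n_j = m. Hence π_k(G(w)) ≥ Σ_j C(n_j, k) ≥ αC(q, k) + (m − αq)c.
module Submission where

open import Defs
open import Data.Nat using (ℕ; _≤_)
open import Data.Fin using (Fin)

open import Data.Bool as Bool using (Bool; true; false; T; _∧_; if_then_else_)
open import Data.Bool.ListAction using (all)
open import Data.Bool.Properties using (T-∧; T-∨; T-≡)
open import Data.Empty using (⊥-elim)
open import Data.Fin using (zero; suc; _≟_; toℕ; fromℕ<)
open import Data.Fin.Properties using (toℕ-fromℕ<)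
open import Data.Fin.Subset using (Subset; _∈_; _∉_; ∣_∣)
open import Data.Fin.Subset.Properties using (_∈?_)
open import Data.List using (List; []; _∷_; _++_; map; concatMap; filter; length; tabulate; upTo; allFin)
open import Data.List.Membership.Propositional using () renaming (_∈_ to _∈ₗ_)
open import Data.List.Membership.Propositional.Properties using (∈-map⁻)
open import Data.List.Properties using (length-upTo)
open import Data.List.Relation.Binary.Disjoint.Propositional using (Disjoint)
open import Data.List.Relation.Binary.Sublist.Propositional using (_⊆_; []; _∷_; _∷ʳ_; minimum)
open import Data.List.Relation.Binary.Sublist.Propositional.Properties using (All-resp-⊆)
open import Data.List.Relation.Unary.All as All using (All; []; _∷_)
import Data.List.Relation.Unary.All.Properties as All
open import Data.List.Relation.Unary.AllPairs as AllPairs using (AllPairs; []; _∷_)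
import Data.List.Relation.Unary.AllPairs.Properties as AllPairs
open import Data.List.Relation.Unary.Unique.Propositional using (Unique)
import Data.List.Relation.Unary.Unique.Propositional.Properties as Unique
open import Data.Nat using (zero; suc; _+_; _*_; _∸_; _/_; _<_; _≡ᵇ_; NonZero; >-nonZero⁻¹; z≤n; s≤s)
open import Data.Nat.Combinatorics using (_C_; nCk+nC[k+1]≡[n+1]C[k+1])
open import Data.Nat.DivMod using (/-monoˡ-≤; +-distrib-/-∣ʳ; n/n≡1)
open import Data.Nat.Divisibility using (∣-refl)
import Data.Nat.ListAction as List
open import Data.Nat.Properties
  using ( ≤-refl; ≤-trans; ≤-reflexive; ≤-antisym; ≤-total; module ≤-Reasoning
        ; +-comm; +-assoc; +-identityʳ; +-mono-≤; +-monoˡ-≤; +-monoʳ-≤; *-monoʳ-≤; *-distribʳ-+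
        ; +-cancelʳ-≤; +-cancelˡ-≡; m≤n+m; m≤m+n; n≤1+n; m≤n⇒m≤1+n; m≤n⇒m<n∨m≡n; n≮0
        ; m∸n≤m; m∸n+n≡m; +-∸-assoc; ≡ᵇ⇒≡; +-*-semiring; +-commutativeSemigroup)
open import Algebra.Properties.CommutativeSemigroup +-commutativeSemigroup using (x∙yz≈y∙xz)
open import Algebra.Properties.Semiring.Sum +-*-semiring
  using (sum-syntax; sum-cong-≗; ∑-distrib-+; *-distribʳ-sum; sum-replicate-zero)
open import Data.Product using (Σ; _×_; _,_; proj₁; proj₂)
open import Data.Sum as Sum using (_⊎_; inj₁; inj₂; [_,_]′)
open import Data.Unit using (tt)
open import Data.Vec as Vec using (lookup)
open import Data.Vec.Properties using (lookup∘tabulate; []=⇒lookup; lookup⇒[]=)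
open import Function using (_∘_; _⇔_; mk⇔; Equivalence)
open import Relation.Nullary using (Dec; does; yes; no; contradiction)
open import Relation.Binary.PropositionalEquality
  using (_≡_; _≢_; refl; trans; cong; cong₂; subst; module ≡-Reasoning)
import Relation.Binary.PropositionalEquality as ≡

-- Counting

private
  variable
    A B : Set

T-does : ∀ {P : Set} (P? : Dec P) → T (does P?) ⇔ P
T-does (yes p)  = mk⇔ (λ _ → p) (λ _ → tt)
T-does (no ¬p) = mk⇔ (λ ()) ¬p

count : (A → Bool) → List A → ℕ
count p []       = 0
count p (x ∷ xs) = (if p x then 1 else 0) + count p xs

length-filter≡count : ∀ (p : A → Bool) xs →
  length (filter (λ x → p x Bool.≟ true) xs) ≡ count p xs
length-filter≡count p []       = refl
length-filter≡count p (x ∷ xs) with p x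
... | true  = cong suc (length-filter≡count p xs)
... | false = length-filter≡count p xs

count-++ : ∀ (p : A → Bool) xs ys → count p (xs ++ ys) ≡ count p xs + count p ys
count-++ p []       ys = refl
count-++ p (x ∷ xs) ys = trans (cong (_ +_) (count-++ p xs ys)) (≡.sym (+-assoc (if p x then 1 else 0) _ _))

count-map : ∀ (p : B → Bool) (f : A → B) xs → count p (map f xs) ≡ count (p ∘ f) xs
count-map p f []       = refl
count-map p f (x ∷ xs) = cong (_ +_) (count-map p f xs)

count-concatMap : ∀ (p : B → Bool) (f : A → List B) xs →
  count p (concatMap f xs) ≡ List.sum (map (count p ∘ f) xs)
count-concatMap p f []       = refl
count-concatMap p f (x ∷ xs) = trans (count-++ p (f x) _) (cong (_ +_) (count-concatMap p f xs))

count-true : ∀ (xs : List A) → count (λ _ → true) xs ≡ length xs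
count-true []       = refl
count-true (x ∷ xs) = cong suc (count-true xs)

count-false : ∀ (xs : List A) → count (λ _ → false) xs ≡ 0
count-false []       = refl
count-false (x ∷ xs) = count-false xs

count-guard : ∀ b (p : A → Bool) xs → count (λ x → b ∧ p x) xs ≡ (if b then count p xs else 0)
count-guard true  p xs = refl
count-guard false p xs = count-false xs

count-mono : ∀ {p q : A → Bool} {xs} → All (λ x → T (p x) → T (q x)) xs → count p xs ≤ count q xs
count-mono []                       = z≤n
count-mono {p = p} {q = q} {xs = x ∷ _} (p⇒q ∷ ps⇒qs) with p x | q x
... | true  | true  = s≤s (count-mono ps⇒qs)
... | true  | false = ⊥-elim (p⇒q tt)
... | false | true  = m≤n⇒m≤1+n (count-mono ps⇒qs)
... | false | false = count-mono ps⇒qs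

choose-⊆ : ∀ k (xs : List A) → All (_⊆ xs) (choose k xs)
choose-⊆ zero    xs       = minimum xs ∷ []
choose-⊆ (suc k) []       = []
choose-⊆ (suc k) (x ∷ xs) =
  All.++⁺ (All.map⁺ (All.map (refl ∷_) (choose-⊆ k xs))) (All.map (x ∷ʳ_) (choose-⊆ (suc k) xs))

AllPairs-resp-⊆ : ∀ {R : A → A → Set} {xs ys} → ys ⊆ xs → AllPairs R xs → AllPairs R ys
AllPairs-resp-⊆ []         []         = []
AllPairs-resp-⊆ (_ ∷ʳ τ)   (_ ∷ rs)   = AllPairs-resp-⊆ τ rs
AllPairs-resp-⊆ (refl ∷ τ) (r ∷ rs)   = All-resp-⊆ τ r ∷ AllPairs-resp-⊆ τ rs

T-isClique : ∀ {r : A → A → Bool} {c} → T (isClique r c) ⇔ AllPairs (λ x y → T (r x y)) c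
T-isClique {c = []}        = mk⇔ (λ _ → []) (λ _ → tt)
T-isClique {r = r} {c = x ∷ c} = mk⇔
  (λ t → let (rx , rc) = Equivalence.to T-∧ t in All.all⁺ (r x) c rx ∷ Equivalence.to T-isClique rc)
  (λ { (rx ∷ rc) → Equivalence.from T-∧ (All.all⁻ (r x) rx , Equivalence.from T-isClique rc) })

∑-const : ∀ n c → ∑[ i < n ] c ≡ n * c
∑-const zero    c = refl
∑-const (suc n) c = cong (c +_) (∑-const n c)

∑-mono-≤ : ∀ {n} {f g : Fin n → ℕ} → (∀ i → f i ≤ g i) → ∑[ i < n ] f i ≤ ∑[ i < n ] g i
∑-mono-≤ {zero}  f≤g = z≤n
∑-mono-≤ {suc n} f≤g = +-mono-≤ (f≤g zero) (∑-mono-≤ (f≤g ∘ suc))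

∑-δ : ∀ {n} (a : Fin n) (h : Fin n → ℕ) → ∑[ i < n ] (if does (a ≟ i) then h i else 0) ≡ h a
∑-δ {suc n} zero    h = trans (cong (h zero +_) (sum-replicate-zero n)) (+-identityʳ (h zero))
∑-δ {suc n} (suc a) h = ∑-δ a (h ∘ suc)

∑-indicator : ∀ {n} (U : Subset n) t → ∑[ v < n ] (if lookup U v then t else 0) ≡ ∣ U ∣ * t
∑-indicator Vec.[]           t = refl
∑-indicator (true  Vec.∷ U) t = cong (t +_) (∑-indicator U t)
∑-indicator (false Vec.∷ U) t = ∑-indicator U t

sum-map-tabulate : ∀ {n} (h : A → ℕ) (f : Fin n → A) → List.sum (map h (tabulate f)) ≡ ∑[ i < n ] h (f i)
sum-map-tabulate {n = zero}  h f = refl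
sum-map-tabulate {n = suc n} h f = cong (h (f zero) +_) (sum-map-tabulate h (f ∘ suc))

total≡∑ : ∀ G w → total G w ≡ ∑[ v < n G ] w v
total≡∑ G w = sum-map-tabulate w (λ v → v)

-- Binomial coefficients

pascal : ∀ n k → suc n C suc k ≡ n C k + n C suc k
pascal n k = ≡.sym (nCk+nC[k+1]≡[n+1]C[k+1] n k)

pascal-if : ∀ b n k → ((if b then 1 else 0) + n) C suc k ≡ (if b then n C k else 0) + n C suc k
pascal-if true  n k = pascal n k
pascal-if false n k = refl

C-monoˡ-≤ : ∀ {m n} k → m ≤ n → m C k ≤ n C k
C-monoˡ-≤ zero    _                   = ≤-refl
C-monoˡ-≤ (suc k) z≤n                 = z≤n
C-monoˡ-≤ (suc k) (s≤s {m} {n} m≤n) = begin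
  suc m C suc k      ≡⟨ pascal m k ⟩
  m C k + m C suc k  ≤⟨ +-mono-≤ (C-monoˡ-≤ k m≤n) (C-monoˡ-≤ (suc k) m≤n) ⟩
  n C k + n C suc k  ≡⟨ pascal n k ⟨
  suc n C suc k      ∎
  where open ≤-Reasoning

C-growth-above : ∀ q d k → q C suc k + d * (q C k) ≤ (d + q) C suc k
C-growth-above q zero    k = ≤-reflexive (+-identityʳ (q C suc k))
C-growth-above q (suc d) k = begin
  q C suc k + (q C k + d * (q C k))  ≡⟨ x∙yz≈y∙xz (q C suc k) (q C k) _ ⟩
  q C k + (q C suc k + d * (q C k))  ≤⟨ +-mono-≤ (C-monoˡ-≤ k (m≤n+m q d)) (C-growth-above q d k) ⟩
  (d + q) C k + (d + q) C suc k      ≡⟨ pascal (d + q) k ⟨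
  suc (d + q) C suc k                ∎
  where open ≤-Reasoning

C-growth-below : ∀ x d k → (d + x) C suc k ≤ x C suc k + d * ((d + x) C k)
C-growth-below x zero    k = ≤-reflexive (≡.sym (+-identityʳ (x C suc k)))
C-growth-below x (suc d) k = begin
  suc (d + x) C suc k                                   ≡⟨ pascal (d + x) k ⟩
  (d + x) C k + (d + x) C suc k                         ≤⟨ +-monoʳ-≤ _ (C-growth-below x d k) ⟩
  (d + x) C k + (x C suc k + d * ((d + x) C k))         ≤⟨ +-mono-≤ c≤c′ (+-monoʳ-≤ _ (*-monoʳ-≤ d c≤c′)) ⟩
  (suc d + x) C k + (x C suc k + d * ((suc d + x) C k)) ≡⟨ x∙yz≈y∙xz ((suc d + x) C k) (x C suc k) _ ⟩
  x C suc k + suc d * ((suc d + x) C k)                 ∎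
  where
  open ≤-Reasoning
  c≤c′ : (d + x) C k ≤ (suc d + x) C k
  c≤c′ = C-monoˡ-≤ k (n≤1+n (d + x))

-- C(x, k+1) ≥ C(q, k+1) + (x − q)·C(q, k), with the subtracted term moved to the right.
C-tangent : ∀ q x k → q C suc k + x * (q C k) ≤ x C suc k + q * (q C k)
C-tangent q x k with ≤-total q x
... | inj₁ q≤x = subst (λ y → q C suc k + y * (q C k) ≤ y C suc k + q * (q C k)) (m∸n+n≡m q≤x) (above (x ∸ q))
  where
  above : ∀ d → q C suc k + (d + q) * (q C k) ≤ (d + q) C suc k + q * (q C k)
  above d = begin
    q C suc k + (d + q) * (q C k)            ≡⟨ cong (q C suc k +_) (*-distribʳ-+ (q C k) d q) ⟩
    q C suc k + (d * (q C k) + q * (q C k))  ≡⟨ +-assoc (q C suc k) _ _ ⟨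
    q C suc k + d * (q C k) + q * (q C k)    ≤⟨ +-monoˡ-≤ _ (C-growth-above q d k) ⟩
    (d + q) C suc k + q * (q C k)            ∎
    where open ≤-Reasoning
... | inj₂ x≤q = subst (λ y → y C suc k + x * (y C k) ≤ x C suc k + y * (y C k)) (m∸n+n≡m x≤q) (below (q ∸ x))
  where
  below : ∀ d → (d + x) C suc k + x * ((d + x) C k) ≤ x C suc k + (d + x) * ((d + x) C k)
  below d = begin
    (d + x) C suc k + x * c            ≤⟨ +-monoˡ-≤ _ (C-growth-below x d k) ⟩
    x C suc k + d * c + x * c          ≡⟨ +-assoc (x C suc k) _ _ ⟩
    x C suc k + (d * c + x * c)        ≡⟨ cong (x C suc k +_) (*-distribʳ-+ c d x) ⟨
    x C suc k + (d + x) * c            ∎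
    where
    open ≤-Reasoning
    c = (d + x) C k

C-tangent-exact : ∀ q x k → x ≡ q ⊎ x ≡ suc q → x C suc k + q * (q C k) ≡ q C suc k + x * (q C k)
C-tangent-exact q x k (inj₁ refl) = refl
C-tangent-exact q x k (inj₂ refl) = begin
  suc q C suc k + q * (q C k)          ≡⟨ cong (_+ q * (q C k)) (pascal q k) ⟩
  q C k + q C suc k + q * (q C k)      ≡⟨ +-assoc (q C k) _ _ ⟩
  q C k + (q C suc k + q * (q C k))    ≡⟨ x∙yz≈y∙xz (q C k) (q C suc k) _ ⟩
  q C suc k + suc q * (q C k)          ∎
  where open ≡-Reasoning

∑-C-tangent : ∀ {a} q k (s : Fin a → ℕ) →
  a * (q C suc k) + (∑[ j < a ] s j) * (q C k) ≤ ∑[ j < a ] (s j C suc k) + a * (q * (q C k))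
∑-C-tangent {a} q k s = begin
  a * (q C suc k) + (∑[ j < a ] s j) * (q C k)         ≡⟨ cong₂ _+_ (∑-const a _) (≡.sym (*-distribʳ-sum (q C k) s)) ⟨
  ∑[ j < a ] (q C suc k) + ∑[ j < a ] (s j * (q C k))  ≡⟨ ∑-distrib-+ (λ _ → q C suc k) (λ j → s j * (q C k)) ⟨
  ∑[ j < a ] (q C suc k + s j * (q C k))               ≤⟨ ∑-mono-≤ (λ j → C-tangent q (s j) k) ⟩
  ∑[ j < a ] (s j C suc k + q * (q C k))               ≡⟨ ∑-distrib-+ (λ j → s j C suc k) (λ _ → q * (q C k)) ⟩
  ∑[ j < a ] (s j C suc k) + ∑[ j < a ] (q * (q C k))  ≡⟨ cong (_ +_) (∑-const a _) ⟩
  ∑[ j < a ] (s j C suc k) + a * (q * (q C k))         ∎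
  where open ≤-Reasoning

∑-C-balanced : ∀ {n} q k (s : Fin n → ℕ) (U : Subset n) →
  (∀ v → v ∉ U → s v ≡ 0) → (∀ v → v ∈ U → s v ≡ q ⊎ s v ≡ suc q) →
  ∑[ v < n ] (s v C suc k) + ∣ U ∣ * (q * (q C k)) ≡ ∣ U ∣ * (q C suc k) + (∑[ v < n ] s v) * (q C k)
∑-C-balanced {n} q k s U s-off s-on = begin
  ∑[ v < n ] (s v C suc k) + ∣ U ∣ * t
    ≡⟨ cong (_ +_) (∑-indicator U t) ⟨
  ∑[ v < n ] (s v C suc k) + ∑[ v < n ] (if lookup U v then t else 0)
    ≡⟨ ∑-distrib-+ (λ v → s v C suc k) (λ v → if lookup U v then t else 0) ⟨
  ∑[ v < n ] (s v C suc k + (if lookup U v then t else 0))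
    ≡⟨ sum-cong-≗ tangent-exact ⟩
  ∑[ v < n ] ((if lookup U v then q C suc k else 0) + s v * (q C k))
    ≡⟨ ∑-distrib-+ (λ v → if lookup U v then q C suc k else 0) (λ v → s v * (q C k)) ⟩
  ∑[ v < n ] (if lookup U v then q C suc k else 0) + ∑[ v < n ] (s v * (q C k))
    ≡⟨ cong₂ _+_ (∑-indicator U (q C suc k)) (≡.sym (*-distribʳ-sum (q C k) s)) ⟩
  ∣ U ∣ * (q C suc k) + (∑[ v < n ] s v) * (q C k)
    ∎
  where
  open ≡-Reasoning
  t = q * (q C k)
  tangent-exact : ∀ v → s v C suc k + (if lookup U v then t else 0) ≡ (if lookup U v then q C suc k else 0) + s v * (q C k)
  tangent-exact v with lookup U v in e
  ... | true  = C-tangent-exact q (s v) k (s-on v (lookup⇒[]= v U e))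
  ... | false rewrite s-off v (λ v∈U → contradiction (trans (≡.sym ([]=⇒lookup v∈U)) e) λ ()) = refl

-- Counting cliques through a classification of the vertices

module _ {a : ℕ} (cl : A → Fin a) where

  inClass : Fin a → A → Bool
  inClass j y = does (cl y ≟ j)

  classSize : Fin a → List A → ℕ
  classSize j = count (inClass j)

  monochromatic : List A → Bool
  monochromatic []      = true
  monochromatic (x ∷ c) = all (inClass (cl x)) c

  ∑-classSize : ∀ xs → ∑[ j < a ] classSize j xs ≡ length xs
  ∑-classSize []       = sum-replicate-zero a
  ∑-classSize (x ∷ xs) = begin
    ∑[ j < a ] ((if inClass j x then 1 else 0) + classSize j xs)
      ≡⟨ ∑-distrib-+ (λ j → if inClass j x then 1 else 0) (λ j → classSize j xs) ⟩
    ∑[ j < a ] (if inClass j x then 1 else 0) + ∑[ j < a ] classSize j xs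
      ≡⟨ cong₂ _+_ (∑-δ (cl x) (λ _ → 1)) (∑-classSize xs) ⟩
    suc (length xs)
      ∎
    where open ≡-Reasoning

  count-inClass-subsets : ∀ k j xs → count (all (inClass j)) (choose k xs) ≡ classSize j xs C k
  count-inClass-subsets zero    j xs       = refl
  count-inClass-subsets (suc k) j []       = refl
  count-inClass-subsets (suc k) j (x ∷ xs) = begin
    count (all (inClass j)) (map (x ∷_) (choose k xs) ++ choose (suc k) xs)
      ≡⟨ count-++ (all (inClass j)) (map (x ∷_) (choose k xs)) _ ⟩
    count (all (inClass j)) (map (x ∷_) (choose k xs)) + count (all (inClass j)) (choose (suc k) xs)
      ≡⟨ cong₂ _+_ (count-map (all (inClass j)) (x ∷_) (choose k xs)) (count-inClass-subsets (suc k) j xs) ⟩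
    count (λ c → inClass j x ∧ all (inClass j) c) (choose k xs) + classSize j xs C suc k
      ≡⟨ cong (_+ classSize j xs C suc k) (count-guard (inClass j x) (all (inClass j)) (choose k xs)) ⟩
    (if inClass j x then count (all (inClass j)) (choose k xs) else 0) + classSize j xs C suc k
      ≡⟨ cong (λ t → (if inClass j x then t else 0) + classSize j xs C suc k) (count-inClass-subsets k j xs) ⟩
    (if inClass j x then classSize j xs C k else 0) + classSize j xs C suc k
      ≡⟨ pascal-if (inClass j x) (classSize j xs) k ⟨
    classSize j (x ∷ xs) C suc k
      ∎
    where open ≡-Reasoning

  count-monochromatic : ∀ k xs → count monochromatic (choose (suc k) xs) ≡ ∑[ j < a ] (classSize j xs C suc k)
  count-monochromatic k []       = ≡.sym (sum-replicate-zero a)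
  count-monochromatic k (x ∷ xs) = begin
    count monochromatic (map (x ∷_) (choose k xs) ++ choose (suc k) xs)
      ≡⟨ count-++ monochromatic (map (x ∷_) (choose k xs)) _ ⟩
    count monochromatic (map (x ∷_) (choose k xs)) + count monochromatic (choose (suc k) xs)
      ≡⟨ cong₂ _+_ (count-map monochromatic (x ∷_) (choose k xs)) (count-monochromatic k xs) ⟩
    count (all (inClass (cl x))) (choose k xs) + ∑[ j < a ] (classSize j xs C suc k)
      ≡⟨ cong (_+ ∑[ j < a ] (classSize j xs C suc k)) (count-inClass-subsets k (cl x) xs) ⟩
    classSize (cl x) xs C k + ∑[ j < a ] (classSize j xs C suc k)
      ≡⟨ cong (_+ ∑[ j < a ] (classSize j xs C suc k)) (∑-δ (cl x) (λ j → classSize j xs C k)) ⟨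
    ∑[ j < a ] (if inClass j x then classSize j xs C k else 0) + ∑[ j < a ] (classSize j xs C suc k)
      ≡⟨ ∑-distrib-+ (λ j → if inClass j x then classSize j xs C k else 0) (λ j → classSize j xs C suc k) ⟨
    ∑[ j < a ] ((if inClass j x then classSize j xs C k else 0) + classSize j xs C suc k)
      ≡⟨ sum-cong-≗ (λ j → pascal-if (inClass j x) (classSize j xs) k) ⟨
    ∑[ j < a ] (classSize j (x ∷ xs) C suc k)
      ∎
    where open ≡-Reasoning

  cliqueCount-≥ : ∀ k {adj : A → A → Bool} {xs} → Unique xs →
    (∀ {y z} → y ≢ z → cl y ≡ cl z → T (adj y z)) →
    ∑[ j < a ] (classSize j xs C suc k) ≤ cliqueCount (suc k) xs adj
  cliqueCount-≥ k {adj} {xs} xs-unique sameClass⇒adj = begin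
    ∑[ j < a ] (classSize j xs C suc k)        ≡⟨ count-monochromatic k xs ⟨
    count monochromatic (choose (suc k) xs)    ≤⟨ count-mono (All.map monochromatic⇒clique subsets-unique) ⟩
    count (isClique adj) (choose (suc k) xs)   ≡⟨ length-filter≡count (isClique adj) (choose (suc k) xs) ⟨
    cliqueCount (suc k) xs adj                 ∎
    where
    open ≤-Reasoning
    subsets-unique : All Unique (choose (suc k) xs)
    subsets-unique = All.map (λ c⊆xs → AllPairs-resp-⊆ c⊆xs xs-unique) (choose-⊆ (suc k) xs)
    oneClass⇒clique : ∀ {j c} → Unique c → All (λ y → cl y ≡ j) c → AllPairs (λ y z → T (adj y z)) c
    oneClass⇒clique []           []         = []
    oneClass⇒clique (y≢ ∷ c-unique) (y∈j ∷ c∈j) =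
      All.zipWith (λ (y≢z , z∈j) → sameClass⇒adj y≢z (trans y∈j (≡.sym z∈j))) (y≢ , c∈j)
        ∷ oneClass⇒clique c-unique c∈j
    monochromatic⇒clique : ∀ {c} → Unique c → T (monochromatic c) → T (isClique adj c)
    monochromatic⇒clique {[]}    _        _    = tt
    monochromatic⇒clique {x ∷ c} c-unique mono = Equivalence.from T-isClique
      (oneClass⇒clique c-unique
        (refl ∷ All.map (λ {y} → Equivalence.to (T-does (cl y ≟ cl x))) (All.all⁺ (inClass (cl x)) c mono)))

  cliqueCount-≤ : ∀ k {adj : A → A → Bool} {P : A → Set} {xs} → All P xs →
    (∀ {y z} → P y → P z → T (adj y z) → cl y ≡ cl z) →
    cliqueCount (suc k) xs adj ≤ ∑[ j < a ] (classSize j xs C suc k)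
  cliqueCount-≤ k {adj} {P} {xs} P-xs adj⇒sameClass = begin
    cliqueCount (suc k) xs adj                 ≡⟨ length-filter≡count (isClique adj) (choose (suc k) xs) ⟩
    count (isClique adj) (choose (suc k) xs)   ≤⟨ count-mono (All.map clique⇒monochromatic subsets-P) ⟩
    count monochromatic (choose (suc k) xs)    ≡⟨ count-monochromatic k xs ⟩
    ∑[ j < a ] (classSize j xs C suc k)        ∎
    where
    open ≤-Reasoning
    subsets-P : All (All P) (choose (suc k) xs)
    subsets-P = All.map (λ c⊆xs → All-resp-⊆ c⊆xs P-xs) (choose-⊆ (suc k) xs)
    clique⇒monochromatic : ∀ {c} → All P c → T (isClique adj c) → T (monochromatic c)
    clique⇒monochromatic []           _      = tt
    clique⇒monochromatic {x ∷ c} (Px ∷ P-c) clique with Equivalence.to T-isClique clique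
    ... | adj-x ∷ _ = All.all⁻ (inClass (cl x)) (All.zipWith
      (λ {y} (Py , xy) → Equivalence.from (T-does (cl y ≟ cl x)) (≡.sym (adj⇒sameClass Px Py xy))) (P-c , adj-x))

-- Blow-ups of complete multipartite graphs

fibre : ∀ {n r} → (Fin n → Fin r) → Fin r → Subset n
fibre f j = Vec.tabulate (λ x → does (f x ≟ j))

∈-fibre⇒ : ∀ {n r} {f : Fin n → Fin r} {j x} → x ∈ fibre f j → f x ≡ j
∈-fibre⇒ {f = f} {j} {x} x∈ = Equivalence.to (T-does (f x ≟ j))
  (Equivalence.from T-≡ (trans (≡.sym (lookup∘tabulate _ x)) ([]=⇒lookup x∈)))

fibre-independent : ∀ G {r} (f : Fin (n G) → Fin r) → (∀ x y → adj G x y ≡ true → f x ≢ f y) →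
  ∀ j → IsIndependent G (fibre f j)
fibre-independent G f adj⇒≢ j x y x∈ y∈ with adj G x y in e
... | true  = contradiction (trans (∈-fibre⇒ {f = f} x∈) (≡.sym (∈-fibre⇒ {f = f} y∈))) (adj⇒≢ x y e)
... | false = refl

fibreRank : ∀ {n r} → (Fin n → Fin r) → Fin r → Fin n → ℕ
fibreRank f j zero    = 0
fibreRank f j (suc x) = (if does (f zero ≟ j) then 1 else 0) + fibreRank (f ∘ suc) j x

fibreRank<∣fibre∣ : ∀ {n r} (f : Fin n → Fin r) {j} x → f x ≡ j → fibreRank f j x < ∣ fibre f j ∣
fibreRank<∣fibre∣ f {j} zero fx≡j with f zero ≟ j
... | yes _   = s≤s z≤n
... | no fx≢j = contradiction fx≡j fx≢j
fibreRank<∣fibre∣ f {j} (suc x) fx≡j with does (f zero ≟ j)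
... | true  = s≤s (fibreRank<∣fibre∣ (f ∘ suc) x fx≡j)
... | false = fibreRank<∣fibre∣ (f ∘ suc) x fx≡j

fibreRank-injective : ∀ {n r} (f : Fin n → Fin r) {j x y} → f x ≡ j → f y ≡ j →
  fibreRank f j x ≡ fibreRank f j y → x ≡ y
fibreRank-injective f {j} {zero}  {zero}  _    _    _  = refl
fibreRank-injective f {j} {zero}  {suc y} fx≡j _    eq with f zero ≟ j
... | yes _   = contradiction eq λ ()
... | no fx≢j = contradiction fx≡j fx≢j
fibreRank-injective f {j} {suc x} {zero}  _    fy≡j eq with f zero ≟ j
... | yes _   = contradiction eq λ ()
... | no fy≢j = contradiction fy≡j fy≢j
fibreRank-injective f {j} {suc x} {suc y} fx≡j fy≡j eq =
  cong suc (fibreRank-injective (f ∘ suc) fx≡j fy≡j (+-cancelˡ-≡ (if does (f zero ≟ j) then 1 else 0) _ _ eq))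

fibrewise-injection : ∀ {n r b} (f : Fin n → Fin r) → (∀ j → ∣ fibre f j ∣ ≤ b) →
  Σ (Fin n → Fin b) λ g → ∀ {x y} → f x ≡ f y → g x ≡ g y → x ≡ y
fibrewise-injection {n} {b = b} f ∣fibre∣≤b = g , g-injective
  where
  rank<b : ∀ x → fibreRank f (f x) x < b
  rank<b x = ≤-trans (fibreRank<∣fibre∣ f x refl) (∣fibre∣≤b (f x))
  g : Fin n → Fin b
  g x = fromℕ< (rank<b x)
  g-injective : ∀ {x y} → f x ≡ f y → g x ≡ g y → x ≡ y
  g-injective {x} {y} fx≡fy gx≡gy = fibreRank-injective f refl (≡.sym fx≡fy) (begin
    fibreRank f (f x) x  ≡⟨ toℕ-fromℕ< (rank<b x) ⟨
    toℕ (g x)            ≡⟨ cong toℕ gx≡gy ⟩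
    toℕ (g y)            ≡⟨ toℕ-fromℕ< (rank<b y) ⟩
    fibreRank f (f y) y  ≡⟨ cong (λ j → fibreRank f j y) fx≡fy ⟨
    fibreRank f (f x) y  ∎)
    where open ≡-Reasoning

copies : ∀ {n} → (Fin n → ℕ) → Fin n → List (Fin n × ℕ)
copies w v = map (v ,_) (upTo (w v))

∈-copies⇒ : ∀ {n} {w : Fin n → ℕ} {v y} → y ∈ₗ copies w v → proj₁ y ≡ v
∈-copies⇒ {v = v} y∈ with ∈-map⁻ (v ,_) y∈
... | _ , _ , refl = refl

count-copies : ∀ {n} (w : Fin n → ℕ) u v →
  count (inClass proj₁ v) (copies w u) ≡ (if does (v ≟ u) then w u else 0)
count-copies w u v = trans (count-map (inClass proj₁ v) (u ,_) (upTo (w u))) constant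
  where
  constant : count (λ _ → does (u ≟ v)) (upTo (w u)) ≡ (if does (v ≟ u) then w u else 0)
  constant with u ≟ v | v ≟ u
  ... | yes _    | yes _    = trans (count-true (upTo (w u))) (length-upTo (w u))
  ... | no _     | no _     = count-false (upTo (w u))
  ... | yes refl | no u≢u   = contradiction refl u≢u
  ... | no u≢u   | yes refl = contradiction refl u≢u

blowup-unique : ∀ G w → Unique (blowupVertices G w)
blowup-unique G w = Unique.concat⁺ (All.map⁺ (All.universal copies-unique (allFin (n G))))
                                   (AllPairs.map⁺ (AllPairs.map copies-disjoint (Unique.allFin⁺ (n G))))
  where
  copies-unique : ∀ v → Unique (copies w v)
  copies-unique v = Unique.map⁺ (cong proj₂) (Unique.upTo⁺ (w v))
  copies-disjoint : ∀ {u v} → u ≢ v → Disjoint (copies w u) (copies w v)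
  copies-disjoint u≢v (y∈u , y∈v) = u≢v (trans (≡.sym (∈-copies⇒ {w = w} y∈u)) (∈-copies⇒ {w = w} y∈v))

blowup-< : ∀ G w → All (λ y → proj₂ y < w (proj₁ y)) (blowupVertices G w)
blowup-< G w = All.concat⁺ (All.map⁺ (All.universal (λ v → All.map⁺ (All.all-upTo (w v))) (allFin (n G))))

classSize-blowup : ∀ G w v → classSize proj₁ v (blowupVertices G w) ≡ w v
classSize-blowup G w v = begin
  count (inClass proj₁ v) (concatMap (copies w) (allFin (n G)))
    ≡⟨ count-concatMap (inClass proj₁ v) (copies w) (allFin (n G)) ⟩
  List.sum (map (count (inClass proj₁ v) ∘ copies w) (allFin (n G)))
    ≡⟨ sum-map-tabulate (count (inClass proj₁ v) ∘ copies w) (λ u → u) ⟩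
  ∑[ u < n G ] count (inClass proj₁ v) (copies w u)
    ≡⟨ sum-cong-≗ (λ u → count-copies w u v) ⟩
  ∑[ u < n G ] (if does (v ≟ u) then w u else 0)
    ≡⟨ ∑-δ v w ⟩
  w v
    ∎
  where open ≡-Reasoning

length-blowup : ∀ G w → length (blowupVertices G w) ≡ total G w
length-blowup G w = begin
  length (blowupVertices G w)                          ≡⟨ ∑-classSize proj₁ (blowupVertices G w) ⟨
  ∑[ v < n G ] classSize proj₁ v (blowupVertices G w)  ≡⟨ sum-cong-≗ (classSize-blowup G w) ⟩
  ∑[ v < n G ] w v                                     ≡⟨ total≡∑ G w ⟨
  total G w                                            ∎
  where open ≡-Reasoning

blowupAdj-copies : ∀ G u i j → i ≢ j → T (blowupAdj G (u , i) (u , j))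
blowupAdj-copies G u i j i≢j with u ≟ u | i ≡ᵇ j in e
... | yes _  | false = tt
... | yes _  | true  = contradiction (≡ᵇ⇒≡ i j (Equivalence.from T-≡ e)) i≢j
... | no u≢u | _     = contradiction refl u≢u

blowupAdj-adj : ∀ G {u v} i j → adj G u v ≡ true → T (blowupAdj G (u , i) (v , j))
blowupAdj-adj G i j uv = Equivalence.from T-∨ (inj₂ (Equivalence.from T-≡ uv))

blowupAdj⇒ : ∀ G y z → T (blowupAdj G y z) → proj₁ y ≡ proj₁ z ⊎ adj G (proj₁ y) (proj₁ z) ≡ true
blowupAdj⇒ G (u , _) (v , _) uv with Equivalence.to T-∨ uv
... | inj₁ copies-uv = inj₁ (Equivalence.to (T-does (u ≟ v)) (proj₁ (Equivalence.to T-∧ copies-uv)))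
... | inj₂ adj-uv    = inj₂ (Equivalence.to T-≡ adj-uv)

πBlowup-≥ : ∀ k G {r b} (f : Fin (n G) → Fin r) → (∀ x y → f x ≢ f y → adj G x y ≡ true) →
  (∀ j → ∣ fibre f j ∣ ≤ b) → ∀ w →
  Σ (Fin b → ℕ) λ s → ∑[ j < b ] s j ≡ total G w × ∑[ j < b ] (s j C suc k) ≤ πBlowup (suc k) G w
πBlowup-≥ k G f ≢⇒adj ∣fibre∣≤b w with fibrewise-injection f ∣fibre∣≤b
... | g , g-injective =
    (λ j → classSize cl j xs)
  , trans (∑-classSize cl xs) (length-blowup G w)
  , cliqueCount-≥ cl k (blowup-unique G w) sameClass⇒adj
  where
  xs = blowupVertices G w
  cl : Fin (n G) × ℕ → Fin _
  cl y = g (proj₁ y)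
  sameClass⇒adj : ∀ {y z} → y ≢ z → cl y ≡ cl z → T (blowupAdj G y z)
  sameClass⇒adj {u , i} {v , j} y≢z gu≡gv with f u ≟ f v
  ... | no fu≢fv = blowupAdj-adj G i j (≢⇒adj u v fu≢fv)
  ... | yes fu≡fv with g-injective fu≡fv gu≡gv
  ...   | refl = blowupAdj-copies G u i j (λ i≡j → y≢z (cong (u ,_) i≡j))

πBlowup-≤ : ∀ k G (U : Subset (n G)) → IsIndependent G U → ∀ w → (∀ v → v ∉ U → w v ≡ 0) →
  πBlowup (suc k) G w ≤ ∑[ v < n G ] (w v C suc k)
πBlowup-≤ k G U U-independent w w-off = begin
  πBlowup (suc k) G w
    ≤⟨ cliqueCount-≤ proj₁ k (All.map (λ {y} → over-U y) (blowup-< G w)) (λ {y} {z} → sameVertex {y} {z}) ⟩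
  ∑[ v < n G ] (classSize proj₁ v (blowupVertices G w) C suc k)
    ≡⟨ sum-cong-≗ (λ v → cong (_C suc k) (classSize-blowup G w v)) ⟩
  ∑[ v < n G ] (w v C suc k)
    ∎
  where
  open ≤-Reasoning
  over-U : ∀ y → proj₂ y < w (proj₁ y) → proj₁ y ∈ U
  over-U (v , i) i<wv with v ∈? U
  ... | yes v∈U = v∈U
  ... | no v∉U  = contradiction (subst (i <_) (w-off v v∉U) i<wv) n≮0
  sameVertex : ∀ {y z} → proj₁ y ∈ U → proj₁ z ∈ U → T (blowupAdj G y z) → proj₁ y ≡ proj₁ z
  sameVertex {y} {z} y∈U z∈U yz with blowupAdj⇒ G y z yz
  ... | inj₁ y≡z    = y≡z
  ... | inj₂ adj-yz = contradiction (trans (≡.sym adj-yz) (U-independent _ _ y∈U z∈U)) λ ()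

[m+n∸1]/n≡m/n⊎1+m/n : ∀ m n .{{_ : NonZero n}} → (m + n ∸ 1) / n ≡ m / n ⊎ (m + n ∸ 1) / n ≡ suc (m / n)
[m+n∸1]/n≡m/n⊎1+m/n m n with m≤n⇒m<n∨m≡n upper
  where
  upper : (m + n ∸ 1) / n ≤ suc (m / n)
  upper = begin
    (m + n ∸ 1) / n  ≤⟨ /-monoˡ-≤ n (m∸n≤m (m + n) 1) ⟩
    (m + n) / n      ≡⟨ +-distrib-/-∣ʳ m (∣-refl {n}) ⟩
    m / n + n / n    ≡⟨ cong (m / n +_) (n/n≡1 n) ⟩
    m / n + 1        ≡⟨ +-comm (m / n) 1 ⟩
    suc (m / n)      ∎
    where open ≤-Reasoning
... | inj₂ ≡1+m/n    = inj₂ ≡1+m/n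
... | inj₁ (s≤s ≤m/n) = inj₁ (≤-antisym ≤m/n (/-monoˡ-≤ n m≤m+n∸1))
  where
  m≤m+n∸1 : m ≤ m + n ∸ 1
  m≤m+n∸1 = ≤-trans (m≤m+n m (n ∸ 1)) (≤-reflexive (≡.sym (+-∸-assoc m (>-nonZero⁻¹ n))))

theorem6 : (m k : ℕ) → 1 ≤ m → 2 ≤ k →
    (G : Graph) → IsCompleteMultipartite G →
    (w w′ : Fin (n G) → ℕ) → IsWeighting G m w → IsWeighting G m w′ →
    IsUniformα G m w′ →
    πBlowup k G w′ ≤ πBlowup k G w
-- The hypothesis 1 ≤ m is unused, and k ≥ 1 would suffice.
theorem6 m zero _ ()
theorem6 m (suc k) _ _ G (_ , f , _ , adj⇔≢) w w′ w-total w′-total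
         (U , (U-independent , U-maximum) , nz , w′-off , w′-on) =
  +-cancelʳ-≤ (α * (q * (q C k))) _ _ (begin
    πBlowup (suc k) G w′ + α * (q * (q C k))         ≤⟨ +-monoˡ-≤ _ (πBlowup-≤ k G U U-independent w′ w′-off) ⟩
    ∑[ v < n G ] (w′ v C suc k) + α * (q * (q C k))  ≡⟨ ∑-C-balanced q k w′ U w′-off w′-on-U ⟩
    α * (q C suc k) + (∑[ v < n G ] w′ v) * (q C k)  ≡⟨ cong (λ t → α * (q C suc k) + t * (q C k)) ∑w′≡∑s ⟩
    α * (q C suc k) + (∑[ j < α ] s j) * (q C k)     ≤⟨ ∑-C-tangent q k s ⟩
    ∑[ j < α ] (s j C suc k) + α * (q * (q C k))     ≤⟨ +-monoˡ-≤ _ s-bound ⟩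
    πBlowup (suc k) G w + α * (q * (q C k))          ∎)
  where
  open ≤-Reasoning
  α = ∣ U ∣
  q = _/_ m α {{nz}}
  classes = πBlowup-≥ k G f (λ x y → Equivalence.from (adj⇔≢ x y))
    (λ j → U-maximum (fibre f j) (fibre-independent G f (λ x y → Equivalence.to (adj⇔≢ x y)) j)) w
  s = proj₁ classes
  s-bound = proj₂ (proj₂ classes)
  ∑w′≡∑s : ∑[ v < n G ] w′ v ≡ ∑[ j < α ] s j
  ∑w′≡∑s = trans (≡.sym (total≡∑ G w′)) (trans w′-total (≡.sym (trans (proj₁ (proj₂ classes)) w-total)))
  w′-on-U : ∀ v → v ∈ U → w′ v ≡ q ⊎ w′ v ≡ suc q
  w′-on-U v v∈U =
    [ inj₁ , (λ ≡⌈m/α⌉ → Sum.map (trans ≡⌈m/α⌉) (trans ≡⌈m/α⌉) ([m+n∸1]/n≡m/n⊎1+m/n m α {{nz}})) ]′ (w′-on v v∈U)
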